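{- Right-uniform, two-inequality semi-unification many-one reduces to left-uniform, two-inequality semi-unification; that is, there is a computable function mapping each triple of terms $(\sigma_0,\sigma_1,\tau)$ to a triple of terms $(\sigma',\tau_0',\tau_1')$ such that there exist substitutions $\varphi,\psi_0,\psi_1$ with $\psi_0(\varphi(\sigma_0))=\varphi(\tau)$ and $\psi_1(\varphi(\sigma_1))=\varphi(\tau)$ if and only if there exist substitutions $\varphi',\psi_0',\psi_1'$ with $\psi_0'(\varphi'(\sigma'))=\varphi'(\tau_0')$ and $\psi_1'(\varphi'(\sigma'))=\varphi'(\tau_1')$.
   Context: Given a countably infinite set $\mathbb{V}$ of variables, terms are given by $\sigma,\tau::=\alpha\mid\sigma\to\tau$ with $\alpha\in\mathbb{V}$. A substitution is a map from $\mathbb{V}$ to terms, lifted homomorphically to terms. Many-one reduction: a computable $f$ with $P(x)\iff Q(f(x))$ for all inputs $x$. -}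

module Defs where

open import Data.Nat using (ℕ)
open import Data.Product using (Σ; _×_; _,_; ∃-syntax)
open import Relation.Binary.PropositionalEquality using (_≡_)

Var : Set
Var = ℕ

data Term : Set where
  var : Var → Term
  _⇒_ : Term → Term → Term

infixr 5 _⇒_

Subst : Set
Subst = Var → Term

_⟨_⟩ : Subst → Term → Term
φ ⟨ var α ⟩ = φ α
φ ⟨ σ ⇒ τ ⟩ = (φ ⟨ σ ⟩) ⇒ (φ ⟨ τ ⟩)

RU2 : Term × Term × Term → Set
RU2 (σ₀ , σ₁ , τ) =
  ∃[ φ ] ∃[ ψ₀ ] ∃[ ψ₁ ]
    ((ψ₀ ⟨ φ ⟨ σ₀ ⟩ ⟩ ≡ φ ⟨ τ ⟩) × (ψ₁ ⟨ φ ⟨ σ₁ ⟩ ⟩ ≡ φ ⟨ τ ⟩))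

LU2 : Term × Term × Term → Set
LU2 (σ , τ₀ , τ₁) =
  ∃[ φ ] ∃[ ψ₀ ] ∃[ ψ₁ ]
    ((ψ₀ ⟨ φ ⟨ σ ⟩ ⟩ ≡ φ ⟨ τ₀ ⟩) × (ψ₁ ⟨ φ ⟨ σ ⟩ ⟩ ≡ φ ⟨ τ₁ ⟩))

-- Map (σ₀, σ₁, τ) to (σ₀ ⇒ σ₁, τ ⇒ z₀, z₁ ⇒ τ) with z₀, z₁ fresh. A left-uniform
-- solution projects onto a right-uniform one by injectivity of ⇒. Conversely, a
-- right-uniform solution (φ, ψ₀, ψ₁) leaves ψ₀(φ σ₁) and ψ₁(φ σ₀) unconstrained;
-- extending φ by z₀ ↦ ψ₀(φ σ₁) and z₁ ↦ ψ₁(φ σ₀) makes them the missing halves.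
module Submission where

open import Defs
open import Data.Product using (Σ; _×_; _,_; proj₁; proj₂)
open import Function.Bundles using (_⇔_; mk⇔)
open import Data.Nat using (suc; _≤_; _<_; _⊔_; _≟_)
open import Data.Nat.Properties
  using (≤-<-trans; <⇒≢; n<1+n; m<n⇒m<1+n; m≤m⊔n; m≤n⊔m; m≤n⇒m≤n⊔o; m⊔n<o⇒m<o; m⊔n<o⇒n<o)
open import Relation.Nullary using (yes; no; contradiction)
open import Relation.Binary.PropositionalEquality
open ≡-Reasoning

⇒-injective : ∀ {a b c d} → a ⇒ b ≡ c ⇒ d → a ≡ c × b ≡ d
⇒-injective refl = refl , refl

maxVar : Term → Var
maxVar (var α) = α
maxVar (s ⇒ t) = maxVar s ⊔ maxVar t

_[_↦_] : Subst → Var → Term → Subst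
(φ [ x ↦ A ]) α with α ≟ x
... | yes _ = A
... | no  _ = φ α

↦-hit : ∀ φ x A → (φ [ x ↦ A ]) x ≡ A
↦-hit φ x A with x ≟ x
... | yes _  = refl
... | no x≢x = contradiction refl x≢x

↦-miss : ∀ φ {x A α} → α ≢ x → (φ [ x ↦ A ]) α ≡ φ α
↦-miss φ {x} {α = α} α≢x with α ≟ x
... | yes α≡x = contradiction α≡x α≢x
... | no  _   = refl

↦-fresh : ∀ φ {x A} t → maxVar t < x → (φ [ x ↦ A ]) ⟨ t ⟩ ≡ φ ⟨ t ⟩
↦-fresh φ (var α) α<x = ↦-miss φ (<⇒≢ α<x)
↦-fresh φ (s ⇒ t) st<x =
  cong₂ _⇒_ (↦-fresh φ s (m⊔n<o⇒m<o _ _ st<x)) (↦-fresh φ t (m⊔n<o⇒n<o _ _ st<x))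

maxVar³ : Term × Term × Term → Var
maxVar³ (σ₀ , σ₁ , τ) = maxVar σ₀ ⊔ maxVar σ₁ ⊔ maxVar τ

reduce : Term × Term × Term → Term × Term × Term
reduce x@(σ₀ , σ₁ , τ) = σ₀ ⇒ σ₁ , τ ⇒ var z₀ , var z₁ ⇒ τ
  where
  z₀ z₁ : Var
  z₀ = suc (maxVar³ x)
  z₁ = suc z₀

LU2-reduce⇒RU2 : ∀ x → LU2 (reduce x) → RU2 x
LU2-reduce⇒RU2 _ (φ , ψ₀ , ψ₁ , e₀ , e₁) =
  φ , ψ₀ , ψ₁ , proj₁ (⇒-injective e₀) , proj₂ (⇒-injective e₁)

RU2⇒LU2-reduce : ∀ x → RU2 x → LU2 (reduce x)
RU2⇒LU2-reduce x@(σ₀ , σ₁ , τ) (φ , ψ₀ , ψ₁ , e₀ , e₁) = φ' , ψ₀ , ψ₁ , e₀' , e₁'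
  where
  m z₀ z₁ : Var
  m  = maxVar³ x
  z₀ = suc m
  z₁ = suc z₀

  A B : Term
  A  = ψ₀ ⟨ φ ⟨ σ₁ ⟩ ⟩
  B  = ψ₁ ⟨ φ ⟨ σ₀ ⟩ ⟩

  φ' : Subst
  φ' = φ [ z₀ ↦ A ] [ z₁ ↦ B ]

  φ'-agrees : ∀ t → maxVar t ≤ m → φ' ⟨ t ⟩ ≡ φ ⟨ t ⟩
  φ'-agrees t t≤m = begin
    φ' ⟨ t ⟩             ≡⟨ ↦-fresh (φ [ z₀ ↦ A ]) t (≤-<-trans t≤m (m<n⇒m<1+n (n<1+n m))) ⟩
    (φ [ z₀ ↦ A ]) ⟨ t ⟩ ≡⟨ ↦-fresh φ t (≤-<-trans t≤m (n<1+n m)) ⟩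
    φ ⟨ t ⟩              ∎

  φ'σ₀ : φ' ⟨ σ₀ ⟩ ≡ φ ⟨ σ₀ ⟩
  φ'σ₀ = φ'-agrees σ₀ (m≤n⇒m≤n⊔o (maxVar τ) (m≤m⊔n (maxVar σ₀) (maxVar σ₁)))

  φ'σ₁ : φ' ⟨ σ₁ ⟩ ≡ φ ⟨ σ₁ ⟩
  φ'σ₁ = φ'-agrees σ₁ (m≤n⇒m≤n⊔o (maxVar τ) (m≤n⊔m (maxVar σ₀) (maxVar σ₁)))

  φ'τ : φ' ⟨ τ ⟩ ≡ φ ⟨ τ ⟩
  φ'τ = φ'-agrees τ (m≤n⊔m (maxVar σ₀ ⊔ maxVar σ₁) (maxVar τ))

  φ'z₀ : φ' z₀ ≡ A
  φ'z₀ = trans (↦-miss (φ [ z₀ ↦ A ]) {z₁} {B} (<⇒≢ (n<1+n z₀))) (↦-hit φ z₀ A)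

  e₀' : ψ₀ ⟨ φ' ⟨ σ₀ ⇒ σ₁ ⟩ ⟩ ≡ φ' ⟨ τ ⇒ var z₀ ⟩
  e₀' = begin
    ψ₀ ⟨ φ' ⟨ σ₀ ⟩ ⟩ ⇒ ψ₀ ⟨ φ' ⟨ σ₁ ⟩ ⟩ ≡⟨ cong₂ (λ a b → ψ₀ ⟨ a ⟩ ⇒ ψ₀ ⟨ b ⟩) φ'σ₀ φ'σ₁ ⟩
    ψ₀ ⟨ φ ⟨ σ₀ ⟩ ⟩ ⇒ A                   ≡⟨ cong₂ _⇒_ e₀ (sym φ'z₀) ⟩
    φ ⟨ τ ⟩ ⇒ φ' z₀                       ≡⟨ cong (_⇒ φ' z₀) (sym φ'τ) ⟩
    φ' ⟨ τ ⟩ ⇒ φ' z₀                      ∎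

  e₁' : ψ₁ ⟨ φ' ⟨ σ₀ ⇒ σ₁ ⟩ ⟩ ≡ φ' ⟨ var z₁ ⇒ τ ⟩
  e₁' = begin
    ψ₁ ⟨ φ' ⟨ σ₀ ⟩ ⟩ ⇒ ψ₁ ⟨ φ' ⟨ σ₁ ⟩ ⟩ ≡⟨ cong₂ (λ a b → ψ₁ ⟨ a ⟩ ⇒ ψ₁ ⟨ b ⟩) φ'σ₀ φ'σ₁ ⟩
    B ⇒ ψ₁ ⟨ φ ⟨ σ₁ ⟩ ⟩                   ≡⟨ cong₂ _⇒_ (sym (↦-hit (φ [ z₀ ↦ A ]) z₁ B)) e₁ ⟩
    φ' z₁ ⇒ φ ⟨ τ ⟩                       ≡⟨ cong (φ' z₁ ⇒_) (sym φ'τ) ⟩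
    φ' z₁ ⇒ φ' ⟨ τ ⟩                      ∎

lemma5p21 : Σ (Term × Term × Term → Term × Term × Term)
              (λ f → (x : Term × Term × Term) → RU2 x ⇔ LU2 (f x))
lemma5p21 = reduce , λ x → mk⇔ (RU2⇒LU2-reduce x) (LU2-reduce⇒RU2 x)
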